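{- Let $G$ be a graph and let $0<\beta_1\le\beta_2\le 1$. Then $\beta_1\text{ -pack}(G)\le \beta_2\text{ -pack}(G)$.
   Context: Let $G=(V,E)$ be a graph, $N(v)=\{u : uv\in E\}$ the open neighborhood of $v$, and fix $\beta$ with $0<\beta\le 1$. A set $S\subsetneq V$ (a proper subset) is a $\beta$-packing set of $G$ if (i) for every $v\in V-S$, $|N(v)\cap S|\le \beta\,|N(v)|$, and (ii) $S$ is maximal with respect to inclusion among proper subsets of $V$ having property (i). The $\beta$-packing number $\beta\text{ -pack}(G)$ is the maximum cardinality of a $\beta$-packing set of $G$. -}

module Defs where

open import Data.Nat.Base using (ℕ)
open import Data.Bool.Base using (Bool; true; false)
open import Data.Fin.Base using (Fin)
open import Data.Fin.Subset using (Subset; _∈_; _∉_; _⊆_; _∩_; ∣_∣)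
open import Data.Vec.Base using (tabulate)
open import Data.Integer.Base using (+_)
open import Data.Rational.Base using (ℚ; _/_; _*_; _≤_)
open import Data.Product.Base using (∃; _×_)
import Data.Nat.Base as ℕ
open import Relation.Binary.PropositionalEquality using (_≡_)

record Graph (n : ℕ) : Set where
  field
    adj       : Fin n → Fin n → Bool
    adj-sym   : ∀ u v → adj u v ≡ adj v u
    adj-irrefl : ∀ v → adj v v ≡ false
open Graph public

N : ∀ {n} → Graph n → Fin n → Subset n
N G v = tabulate (adj G v)

ℕ→ℚ : ℕ → ℚ
ℕ→ℚ k = + k / 1

Proper : ∀ {n} → Subset n → Set
Proper S = ∃ λ v → v ∉ S

Prop-i : ∀ {n} → ℚ → Graph n → Subset n → Set
Prop-i β G S = ∀ v → v ∉ S → ℕ→ℚ ∣ N G v ∩ S ∣ ≤ β * ℕ→ℚ ∣ N G v ∣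

IsPackingSet : ∀ {n} → ℚ → Graph n → Subset n → Set
IsPackingSet β G S =
  Proper S × Prop-i β G S ×
  (∀ T → Proper T → Prop-i β G T → S ⊆ T → T ⊆ S)

IsPackNumber : ∀ {n} → ℚ → Graph n → ℕ → Set
IsPackNumber β G k =
  (∃ λ S → IsPackingSet β G S × ∣ S ∣ ≡ k) ×
  (∀ S → IsPackingSet β G S → ∣ S ∣ ℕ.≤ k)

{-# OPTIONS --safe #-}
module Submission where

open import Defs
open import Data.Nat.Base using (ℕ)
open import Data.Rational.Base using (ℚ; 0ℚ; 1ℚ; _<_; _≤_)
import Data.Nat.Base as ℕ

open import Level using (Level)
open import Data.Fin.Properties using (all?; any?)
open import Data.Fin.Subset using (Subset; _⊆_; _⊂_; _⊃_; _∩_; ∣_∣)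
open import Data.Fin.Subset.Induction using (Acc; acc; ⊃-wellFounded)
open import Data.Fin.Subset.Properties using (_∈?_; _⊆?_; anySubset?; ⊆-refl; ⊆-trans; p⊆q⇒∣p∣≤∣q∣)
import Data.Nat.Properties as ℕ
import Data.Rational.Base as ℚ
import Data.Rational.Properties as ℚ
open import Data.Product.Base using (∃; _×_; _,_)
open import Relation.Binary.Definitions using (Decidable)
open import Relation.Binary.PropositionalEquality using (subst)
open import Relation.Nullary.Decidable using (yes; no; ¬?; _×-dec_; _→-dec_)
open import Data.Empty using (⊥-elim)
open import Relation.Unary using (Pred) renaming (Decidable to Decidable₁)

-- Every proper subset with property (i) extends to a packing set, and property (i)
-- only gets weaker as β grows.  So a maximum β₁-packing set lies inside some
-- β₂-packing set, which is therefore at least as large.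

_⊂?_ : ∀ {n} → Decidable (_⊂_ {n})
S ⊂? T = S ⊆? T ×-dec any? (λ x → x ∈? T ×-dec ¬? (x ∈? S))

module _ {n : ℕ} {ℓ : Level} (P : Pred (Subset n) ℓ) where

  Maximal : Pred (Subset n) ℓ
  Maximal S = P S × (∀ T → P T → S ⊆ T → T ⊆ S)

  extend-to-maximal : Decidable₁ P → ∀ {S} → P S → ∃ λ T → S ⊆ T × Maximal T
  extend-to-maximal P? {S} = go (⊃-wellFounded S)
    where
    go : ∀ {S} → Acc _⊃_ S → P S → ∃ λ T → S ⊆ T × Maximal T
    go {S} (acc rs) pS with anySubset? (λ T → P? T ×-dec S ⊂? T)
    ... | yes (T , pT , S⊂T@(S⊆T , _)) =
      let U , T⊆U , maxU = go (rs S⊂T) pT in U , ⊆-trans S⊆T T⊆U , maxU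
    ... | no ∄bigger = S , ⊆-refl , pS , maximal
      where
      maximal : ∀ T → P T → S ⊆ T → T ⊆ S
      maximal T pT S⊆T {x} x∈T with x ∈? S
      ... | yes x∈S = x∈S
      ... | no x∉S = ⊥-elim (∄bigger (T , pT , S⊆T , x , x∈T , x∉S))

module _ {n : ℕ} (β : ℚ) (G : Graph n) where

  Proper? : Decidable₁ (Proper {n})
  Proper? S = any? (λ v → ¬? (v ∈? S))

  Prop-i? : Decidable₁ (Prop-i β G)
  Prop-i? S = all? (λ v → ¬? (v ∈? S) →-dec (ℕ→ℚ ∣ N G v ∩ S ∣ ℚ.≤? β ℚ.* ℕ→ℚ ∣ N G v ∣))

  maximal⇒packingSet : ∀ {S} → Maximal (λ T → Proper T × Prop-i β G T) S → IsPackingSet β G S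
  maximal⇒packingSet ((pS , iS) , maxS) = pS , iS , λ T pT iT → maxS T (pT , iT)

  extend-to-packingSet : ∀ {S} → Proper S → Prop-i β G S →
                         ∃ λ T → S ⊆ T × IsPackingSet β G T
  extend-to-packingSet pS iS =
    let T , S⊆T , maxT = extend-to-maximal _ (λ T → Proper? T ×-dec Prop-i? T) (pS , iS)
    in T , S⊆T , maximal⇒packingSet maxT

  packingSet-size≤packNumber : ∀ {k S} → IsPackNumber β G k →
                               Proper S → Prop-i β G S → ∣ S ∣ ℕ.≤ k
  packingSet-size≤packNumber (_ , maxk) pS iS =
    let T , S⊆T , packT = extend-to-packingSet pS iS
    in ℕ.≤-trans (p⊆q⇒∣p∣≤∣q∣ S⊆T) (maxk T packT)

Prop-i-mono : ∀ {n} (G : Graph n) {β₁ β₂} → β₁ ≤ β₂ →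
              ∀ {S} → Prop-i β₁ G S → Prop-i β₂ G S
Prop-i-mono G β₁≤β₂ iS v v∉S =
  ℚ.≤-trans (iS v v∉S) (ℚ.*-monoʳ-≤-nonNeg (ℕ→ℚ ∣ N G v ∣) {{ℚ.normalize-nonNeg ∣ N G v ∣ 1}} β₁≤β₂)

proposition3p1 : ∀ {n} (G : Graph n) (β₁ β₂ : ℚ) →
    0ℚ < β₁ → β₁ ≤ β₂ → β₂ ≤ 1ℚ →
    ∀ (k₁ k₂ : ℕ) → IsPackNumber β₁ G k₁ → IsPackNumber β₂ G k₂ →
    k₁ ℕ.≤ k₂
proposition3p1 G β₁ β₂ _ β₁≤β₂ _ k₁ k₂ ((S , (pS , iS , _) , ∣S∣≡k₁) , _) packNumber₂ =
  subst (ℕ._≤ k₂) ∣S∣≡k₁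
    (packingSet-size≤packNumber β₂ G packNumber₂ pS (Prop-i-mono G β₁≤β₂ iS))
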